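{- Let $\Delta = \{(m,n) \in \omega^2 : n \le m\}$, let $e \colon \omega \to \Delta$ be a bijection, and let $\mathcal{I} = \{e^{ -1}[A] : A \in \mathcal{ED}_{\mathrm{fin}}\}$, an ideal on $\omega$. Then Player II has a winning strategy in the tallness game with respect to $\mathcal{I}$.
   Context: $\mathcal{ED}$ is the ideal on $\omega \times \omega$ generated by the vertical lines $\{m\} \times \omega$ and the graphs of functions from $\omega$ to $\omega$; $\mathcal{ED}_{\mathrm{fin}} = \{A \cap \Delta : A \in \mathcal{ED}\}$, an ideal on $\Delta$. For an ideal $\mathcal{I}$ on $\omega$, the tallness game with respect to $\mathcal{I}$ is: in round $k$ Player I plays $n_k \in \omega$, subject to $n_0 < n_1 < \cdots$, and then Player II plays $i_k \in \{0,1\}$; Player II wins if $\{n_k : k \in \omega, i_k = 1\}$ is an infinite member of $\mathcal{I}$; otherwise Player I wins. -}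

module Defs where

open import Level using (0ℓ)
open import Data.Nat using (ℕ; _≤_; _<_; suc)
open import Data.Product using (Σ; ∃; _×_; _,_; proj₁)
open import Data.Bool using (Bool; true)
open import Data.List using (List; applyUpTo)
open import Data.List.Membership.Propositional using (_∈_)
open import Data.List.Relation.Unary.Any using (Any)
open import Data.Sum using (_⊎_)
open import Relation.Binary.PropositionalEquality using (_≡_)
open import Relation.Unary using (Pred)
open import Function.Bundles using (_⇔_; _⤖_; Bijection)

Δ : Set
Δ = Σ (ℕ × ℕ) (λ p → Data.Product.proj₂ p ≤ proj₁ p)

-- A ⊆ ω×ω belongs to ED (the ideal generated by vertical lines {m}×ω and
-- graphs of functions ω → ω) iff A is contained in the union of finitely many
-- vertical lines (those with first coordinate in the list ms) and finitely many
-- graphs (of the functions in the list fs).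
ED : Pred (ℕ × ℕ) 0ℓ → Set
ED A = Σ (List ℕ) λ ms → Σ (List (ℕ → ℕ)) λ fs →
  ∀ m n → A (m , n) → (m ∈ ms) ⊎ Any (λ f → n ≡ f m) fs

-- ED_fin = {A ∩ Δ : A ∈ ED}, an ideal on Δ (subsets of Δ are predicates on Δ).
EDfin : Pred Δ 0ℓ → Set₁
EDfin B = Σ (Pred (ℕ × ℕ) 0ℓ) λ A → ED A × (∀ (d : Δ) → B d ⇔ A (proj₁ d))

ℐ : (ℕ ⤖ Δ) → Pred ℕ 0ℓ → Set₁
ℐ e X = Σ (Pred Δ 0ℓ) λ B → EDfin B × (∀ x → X x ⇔ B (Bijection.to e x))

Infinite : Pred ℕ 0ℓ → Set
Infinite X = ∀ N → ∃ λ x → N ≤ x × X x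

-- Player I plays a strictly increasing sequence n₀ < n₁ < ⋯;
-- in round k, Player II answers i_k ∈ {0,1} (Bool, true = 1) knowing n₀,…,n_k.
StrategyII : Set
StrategyII = List ℕ → Bool

StrictlyIncreasing : (ℕ → ℕ) → Set
StrictlyIncreasing n = ∀ k → n k < n (suc k)

moveII : StrategyII → (ℕ → ℕ) → ℕ → Bool
moveII σ n k = σ (applyUpTo n (suc k))

chosen : StrategyII → (ℕ → ℕ) → Pred ℕ 0ℓ
chosen σ n x = ∃ λ k → moveII σ n k ≡ true × n k ≡ x

WinningII : (Pred ℕ 0ℓ → Set₁) → StrategyII → Set₁
WinningII 𝓘 σ = ∀ (n : ℕ → ℕ) → StrictlyIncreasing n →
  Infinite (chosen σ n) × 𝓘 (chosen σ n)

IIHasWinningStrategy : (Pred ℕ 0ℓ → Set₁) → Set₁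
IIHasWinningStrategy 𝓘 = Σ StrategyII (WinningII 𝓘)

-- II answers 1 exactly when the column of e(n_k) exceeds the columns of all
-- earlier moves.  The chosen points then lie in pairwise distinct columns of Δ,
-- so they lie on the graph of a single function and form a member of ℐ.
-- Since each column of Δ is finite, only finitely many n with e(n) in the first
-- M columns exist, so the columns of e(n_k) are unbounded and II answers 1
-- infinitely often.
module Submission where

open import Defs
open import Level using (0ℓ)
open import Data.Nat using (ℕ; zero; suc; _≤_; _<_; _⊔_; _⊓_; z≤n; s≤s; _<?_; _≟_)
open import Data.Nat.Properties
open import Data.Bool using (Bool; true; false)
open import Data.Bool.Properties using (T-≡)
open import Data.Product using (∃; _×_; _,_; proj₁; proj₂)
open import Data.Sum using (inj₁; inj₂)
open import Data.List using ([]; _∷_; _∷ʳ_; foldl; applyUpTo)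
open import Data.List.Properties using (foldl-∷ʳ; applyUpTo-∷ʳ)
open import Data.List.Relation.Unary.Any using (here)
open import Data.Empty using (⊥-elim)
open import Function using (_∘_)
open import Function.Bundles using (_⤖_; _⇔_; mk⇔; Bijection; Inverse; Equivalence)
open import Function.Properties.Bijection using (⤖⇒↔)
open import Relation.Binary.Definitions using (tri<; tri≈; tri>)
open import Relation.Binary.PropositionalEquality
open import Relation.Nullary using (Dec; does; yes; no; contradiction)
open import Relation.Nullary.Decidable using (dec-true; isYes≗does; toWitness; _×-dec_)
open import Relation.Unary using (Pred)

maxUpTo : (ℕ → ℕ) → ℕ → ℕ
maxUpTo f zero    = f 0
maxUpTo f (suc m) = maxUpTo f m ⊔ f (suc m)

≤-maxUpTo : ∀ f {i m} → i ≤ m → f i ≤ maxUpTo f m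
≤-maxUpTo f {m = zero} z≤n = ≤-refl
≤-maxUpTo f {m = suc m} i≤1+m with m≤n⇒m<n∨m≡n i≤1+m
... | inj₁ i<1+m = ≤-trans (≤-maxUpTo f (m<1+n⇒m≤n i<1+m)) (m≤m⊔n _ _)
... | inj₂ refl  = m≤n⊔m _ _

foldl-applyUpTo-suc : ∀ {A B : Set} (f : B → A → B) z (n : ℕ → A) k →
  foldl f z (applyUpTo n (suc k)) ≡ f (foldl f z (applyUpTo n k)) (n k)
foldl-applyUpTo-suc f z n k = begin
  foldl f z (applyUpTo n (suc k))   ≡⟨ cong (foldl f z) (applyUpTo-∷ʳ n k) ⟨
  foldl f z (applyUpTo n k ∷ʳ n k)  ≡⟨ foldl-∷ʳ f z (n k) (applyUpTo n k) ⟩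
  f (foldl f z (applyUpTo n k)) (n k) ∎
  where open ≡-Reasoning

strictlyIncreasing⇒id≤ : ∀ {n} → StrictlyIncreasing n → ∀ k → k ≤ n k
strictlyIncreasing⇒id≤ increasing zero    = z≤n
strictlyIncreasing⇒id≤ increasing (suc k) =
  ≤-trans (s≤s (strictlyIncreasing⇒id≤ increasing k)) (increasing k)

Δ-≡ : {d d′ : Δ} → proj₁ d ≡ proj₁ d′ → d ≡ d′
Δ-≡ {p , q} {.p , q′} refl = cong (p ,_) (≤-irrelevant q q′)

module Records (h : ℕ → ℕ) where

  prefixMax : ℕ → ℕ
  prefixMax zero    = 0
  prefixMax (suc k) = prefixMax k ⊔ h k

  IsRecord : ℕ → Set
  IsRecord k = prefixMax k < h k

  prefixMax-mono : ∀ {j k} → j ≤ k → prefixMax j ≤ prefixMax k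
  prefixMax-mono {k = zero} z≤n = ≤-refl
  prefixMax-mono {k = suc k} j≤1+k with m≤n⇒m<n∨m≡n j≤1+k
  ... | inj₁ j<1+k = ≤-trans (prefixMax-mono (m<1+n⇒m≤n j<1+k)) (m≤m⊔n _ _)
  ... | inj₂ refl  = ≤-refl

  h≤prefixMax : ∀ {j k} → j < k → h j ≤ prefixMax k
  h≤prefixMax j<k = ≤-trans (m≤n⊔m _ _) (prefixMax-mono j<k)

  record-injective : ∀ {j k} → IsRecord j → IsRecord k → h j ≡ h k → j ≡ k
  record-injective {j} {k} rj rk hj≡hk with <-cmp j k
  ... | tri< j<k _ _ = ⊥-elim (<⇒≢ (≤-<-trans (h≤prefixMax j<k) rk) hj≡hk)
  ... | tri≈ _ j≡k _ = j≡k
  ... | tri> _ _ k<j = ⊥-elim (<⇒≢ (≤-<-trans (h≤prefixMax k<j) rj) (sym hj≡hk))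

  record-before-increase : ∀ {N} k → prefixMax N < prefixMax k → ∃ λ j → N ≤ j × IsRecord j
  record-before-increase {N} (suc k) N<1+k with prefixMax k <? h k
  ... | yes rk  = k , ≮⇒≥ (λ k<N → <⇒≱ N<1+k (prefixMax-mono k<N)) , rk
  ... | no ¬rk = record-before-increase k (<-≤-trans N<1+k (⊔-lub ≤-refl (≮⇒≥ ¬rk)))

  unbounded⇒records-unbounded : (∀ M → ∃ λ k → M < h k) → ∀ N → ∃ λ j → N ≤ j × IsRecord j
  unbounded⇒records-unbounded unbounded N with unbounded (prefixMax N)
  ... | k , N<hk = record-before-increase (suc k) (<-≤-trans N<hk (m≤n⊔m _ _))

module RecordStrategy (g : ℕ → ℕ) where

  recordStep : ℕ × Bool → ℕ → ℕ × Bool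
  recordStep (m , _) x = m ⊔ g x , does (m <? g x)

  recordStrategy : StrategyII
  recordStrategy = proj₂ ∘ foldl recordStep (0 , false)

  module _ (n : ℕ → ℕ) where
    open Records (g ∘ n)

    recordStep-prefixMax : ∀ k → proj₁ (foldl recordStep (0 , false) (applyUpTo n k)) ≡ prefixMax k
    recordStep-prefixMax zero    = refl
    recordStep-prefixMax (suc k) rewrite foldl-applyUpTo-suc recordStep (0 , false) n k =
      cong (_⊔ g (n k)) (recordStep-prefixMax k)

    recordStrategy-move : ∀ k → moveII recordStrategy n k ≡ does (prefixMax k <? g (n k))
    recordStrategy-move k rewrite foldl-applyUpTo-suc recordStep (0 , false) n k =
      cong (λ m → does (m <? g (n k))) (recordStep-prefixMax k)

    recordStrategy-move≡true⇔IsRecord : ∀ k → moveII recordStrategy n k ≡ true ⇔ IsRecord k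
    recordStrategy-move≡true⇔IsRecord k = mk⇔
      (λ move≡true → toWitness {a? = record?} (Equivalence.from T-≡
        (trans (isYes≗does record?) (trans (sym (recordStrategy-move k)) move≡true))))
      (λ rk → trans (recordStrategy-move k) (dec-true record? rk))
      where record? = prefixMax k <? g (n k)

module _ (e : ℕ ⤖ Δ) where
  open Inverse (⤖⇒↔ e) using (to; from; strictlyInverseʳ)

  column height : ℕ → ℕ
  column = proj₁ ∘ proj₁ ∘ to
  height = proj₂ ∘ proj₁ ∘ to

  ⊆graph⇒∈ℐ : (X : Pred ℕ 0ℓ) (f : ℕ → ℕ) → (∀ {x} → X x → height x ≡ f (column x)) → ℐ e X
  ⊆graph⇒∈ℐ X f X⊆graph = image , (A , (A∈ED , image⇔A)) , X⇔image
    where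
    image : Pred Δ 0ℓ
    image d = ∃ λ x → X x × to x ≡ d

    A : Pred (ℕ × ℕ) 0ℓ
    A p = ∃ λ x → X x × proj₁ (to x) ≡ p

    A∈ED : ED A
    A∈ED = [] , f ∷ [] , λ { m n (x , Xx , tox≡mn) → inj₂ (here (begin
      n                ≡⟨ cong proj₂ tox≡mn ⟨
      height x         ≡⟨ X⊆graph Xx ⟩
      f (column x)     ≡⟨ cong (f ∘ proj₁) tox≡mn ⟩
      f m              ∎)) }
      where open ≡-Reasoning

    image⇔A : ∀ d → image d ⇔ A (proj₁ d)
    image⇔A d = mk⇔ (λ { (x , Xx , tox≡d) → x , Xx , cong proj₁ tox≡d })
                    (λ { (x , Xx , tox≡d) → x , Xx , Δ-≡ tox≡d })

    X⇔image : ∀ x → X x ⇔ image (to x)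
    X⇔image x = mk⇔ (λ Xx → x , Xx , refl)
                    (λ { (y , Xy , toy≡tox) → subst X (Bijection.injective e toy≡tox) Xy })

  -- Clamping b to a keeps the point in Δ; only b ≤ a is ever used.
  columnPoint : ℕ → ℕ → ℕ
  columnPoint a b = from ((a , b ⊓ a) , m⊓n≤n b a)

  columnBound : ℕ → ℕ
  columnBound = maxUpTo λ a → maxUpTo (columnPoint a) a

  from≤columnBound : ∀ {M} (d : Δ) → proj₁ (proj₁ d) ≤ M → from d ≤ columnBound M
  from≤columnBound {M} ((a , b) , b≤a) a≤M =
    subst (_≤ columnBound M) (cong from (Δ-≡ (cong (a ,_) (m≤n⇒m⊓n≡m b≤a))))
      (≤-trans (≤-maxUpTo (columnPoint a) b≤a) (≤-maxUpTo (λ a → maxUpTo (columnPoint a) a) a≤M))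

  column≤⇒≤columnBound : ∀ {M} x → column x ≤ M → x ≤ columnBound M
  column≤⇒≤columnBound x column≤M =
    subst (_≤ _) (strictlyInverseʳ x) (from≤columnBound (to x) column≤M)

  open RecordStrategy column

  module _ (n : ℕ → ℕ) (increasing : StrictlyIncreasing n) where
    open Records (column ∘ n)

    columns-unbounded : ∀ M → ∃ λ k → M < column (n k)
    columns-unbounded M = suc B , ≰⇒> λ column≤M →
      1+n≰n (≤-trans (strictlyIncreasing⇒id≤ increasing (suc B)) (column≤⇒≤columnBound (n (suc B)) column≤M))
      where B = columnBound M

    chosen-infinite : Infinite (chosen recordStrategy n)
    chosen-infinite N with unbounded⇒records-unbounded columns-unbounded N
    ... | k , N≤k , rk = n k , ≤-trans N≤k (strictlyIncreasing⇒id≤ increasing k)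
                       , k , Equivalence.from (recordStrategy-move≡true⇔IsRecord n k) rk , refl

    RecordInColumn : ℕ → ℕ → Set
    RecordInColumn a k = IsRecord k × column (n k) ≡ a

    recordInColumn? : ∀ a → Dec (∃ λ k → k < suc (columnBound a) × RecordInColumn a k)
    recordInColumn? a =
      anyUpTo? (λ k → (prefixMax k <? column (n k)) ×-dec (column (n k) ≟ a)) (suc (columnBound a))

    -- Junk value 0 on columns containing no record.  Searching the rounds
    -- k ≤ columnBound a suffices because k ≤ n k.
    heightOfRecordIn : ℕ → ℕ
    heightOfRecordIn a with recordInColumn? a
    ... | yes (k , _) = height (n k)
    ... | no _        = 0

    heightOfRecordIn-correct : ∀ {k} → IsRecord k → heightOfRecordIn (column (n k)) ≡ height (n k)
    heightOfRecordIn-correct {k} rk with recordInColumn? (column (n k))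
    ... | yes (k′ , _ , rk′ , same-column) = cong (height ∘ n) (record-injective rk′ rk same-column)
    ... | no ¬found = contradiction (k , k<1+bound , rk , refl) ¬found
      where
      k<1+bound : k < suc (columnBound (column (n k)))
      k<1+bound = s≤s (≤-trans (strictlyIncreasing⇒id≤ increasing k) (column≤⇒≤columnBound (n k) ≤-refl))

    chosen∈ℐ : ℐ e (chosen recordStrategy n)
    chosen∈ℐ = ⊆graph⇒∈ℐ (chosen recordStrategy n) heightOfRecordIn λ { (k , move≡true , refl) →
      sym (heightOfRecordIn-correct (Equivalence.to (recordStrategy-move≡true⇔IsRecord n k) move≡true)) }

proposition6p2 : (e : ℕ ⤖ Δ) → IIHasWinningStrategy (ℐ e)
proposition6p2 e = RecordStrategy.recordStrategy (column e) , λ n increasing →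
  chosen-infinite e n increasing , chosen∈ℐ e n increasing
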